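{- There exists a set $A\subset\mathbb{N}$ such that $A=\Pr(\Pr(A))$.
   Context: For $m\in\mathbb{N}$, $D(m)$ is the set of positive divisors of $m$. For $A\subset\mathbb{N}$, $S_A=\sum_{a\in A}a$ ($S_\emptyset=0$, $S_A=+\infty$ for infinite $A$), and $A$ is a practical set if every non-negative integer $k\le S_A$ is a sum of distinct elements of $A$. A number $m\in\mathbb{N}$ is $A$-practical if $D(m)\cap A$ is a practical set, and $\Pr(A)$ is the set of all $A$-practical numbers. -}

module Defs where

open import Level using (0ℓ)
open import Data.Nat using (ℕ; _≤_)
open import Data.Nat.Divisibility using (_∣_)
open import Data.List using (List)
open import Data.Nat.ListAction using (sum)
open import Relation.Binary.PropositionalEquality using (_≡_)
open import Data.List.Relation.Unary.All using (All)
open import Data.List.Relation.Unary.Unique.Propositional using (Unique)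
open import Data.Product using (Σ; _×_)
open import Relation.Unary using (Pred)

IsSubsetSum : Pred ℕ 0ℓ → ℕ → Set
IsSubsetSum X k = Σ (List ℕ) λ L → Unique L × All X L × sum L ≡ k

-- k ≤ S_X, where S_X = Σ_{a∈X} a (possibly +∞) is the supremum of the
-- sums of finite subsets of X (X ⊆ positive integers).
≤SumOf : ℕ → Pred ℕ 0ℓ → Set
≤SumOf k X = Σ (List ℕ) λ L → Unique L × All X L × k ≤ sum L

Practical : Pred ℕ 0ℓ → Set
Practical X = ∀ k → ≤SumOf k X → IsSubsetSum X k

DivIn : ℕ → Pred ℕ 0ℓ → Pred ℕ 0ℓ
DivIn m A d = (1 ≤ d) × (d ∣ m) × A d

Pr : Pred ℕ 0ℓ → Pred ℕ 0ℓ
Pr A m = (1 ≤ m) × Practical (DivIn m A)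

-- A finite set of positive integers, listed in decreasing order, is practical
-- iff every element is at most one more than the sum of the smaller ones.
-- So whether m is A-practical is decided by the proper divisors of m in A and
-- by whether m ∈ A.  Build A and B together by strong induction on m, deciding
-- m ∈ A and m ∈ B so that B = Pr(A) and A = Pr(B) hold at m; then
-- Pr(Pr(A)) = Pr(B) = A.  A consistent decision always exists: adding m to
-- the proper divisors of m in A can only destroy practicality, so the map
-- [m ∈ A] ↦ [m ∈ B] ↦ [m ∈ A] is monotone on Bool and has a fixed point.
module Submission where

open import Defs
open import Level using (0ℓ)
open import Data.Bool using (Bool; true; false; T; _∧_; if_then_else_)
open import Data.Bool.Properties using (T-∧)
open import Data.Empty using (⊥-elim)
open import Data.Nat using (ℕ; zero; suc; _+_; _≤_; _<_; _>_; _≤ᵇ_; _<ᵇ_; _≤?_; _≟_; z≤n; s≤s)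
open import Data.Nat.Properties
open import Algebra.Properties.CommutativeSemigroup +-commutativeSemigroup using (x∙yz≈y∙xz)
open import Data.Nat.Divisibility using (_∣?_; ∣⇒≤; ∣-refl)
open import Data.Nat.ListAction using (sum)
open import Data.List using (List; []; _∷_; downFrom; filter)
open import Data.List.Properties using (filter-accept; filter-reject)
open import Data.List.Membership.Propositional using (_∈_; _─_)
open import Data.List.Membership.Propositional.Properties using (∈-downFrom⁺; ∈-downFrom⁻; ∈-filter⁺; ∈-filter⁻)
open import Data.List.Membership.DecPropositional _≟_ using (_∈?_)
open import Data.List.Relation.Unary.Any using (here; there)
open import Data.List.Relation.Unary.All as All using (All; []; _∷_)
open import Data.List.Relation.Unary.AllPairs as AllPairs using (AllPairs; []; _∷_)
open import Data.List.Relation.Unary.AllPairs.Properties using (applyDownFrom⁺₁; filter⁺)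
open import Data.List.Relation.Unary.Unique.Propositional using (Unique)
open import Data.Product using (Σ; _×_; _,_; proj₁; proj₂)
open import Data.Sum using (_⊎_; inj₁; inj₂; [_,_])
open import Function using (_∘_; id; _⇔_; mk⇔; Equivalence)
open import Relation.Nullary using (¬_; yes; no)
open import Relation.Nullary.Decidable using (_×-dec_; T?)
open import Relation.Unary using (Pred; Decidable; _≐_)
open import Relation.Unary.Properties using (≐-sym; ≐-trans)
open import Relation.Binary.PropositionalEquality using (_≡_; _≢_; refl; sym; trans; cong; cong₂; subst)

open Equivalence using (to; from)

Descending : List ℕ → Set
Descending = AllPairs _>_

descending⇒unique : ∀ {xs} → Descending xs → Unique xs
descending⇒unique = AllPairs.map >⇒≢

∈⇒≤sum : ∀ {x xs} → x ∈ xs → x ≤ sum xs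
∈⇒≤sum {xs = y ∷ ys} (here refl) = m≤m+n y (sum ys)
∈⇒≤sum {xs = y ∷ ys} (there x∈ys) = ≤-trans (∈⇒≤sum x∈ys) (m≤n+m (sum ys) y)

sum-─ : ∀ {x xs} (x∈xs : x ∈ xs) → sum xs ≡ x + sum (xs ─ x∈xs)
sum-─ (here refl) = refl
sum-─ {x} {y ∷ ys} (there x∈ys) =
  trans (cong (y +_) (sum-─ x∈ys)) (x∙yz≈y∙xz y x _)

∈-─ : ∀ {x y : ℕ} {xs} (x∈xs : x ∈ xs) → y ∈ xs → y ≢ x → y ∈ xs ─ x∈xs
∈-─ (here refl) (here refl) y≢x = ⊥-elim (y≢x refl)
∈-─ (here refl) (there y∈xs) _ = y∈xs
∈-─ (there x∈xs) (here refl) _ = here refl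
∈-─ (there x∈xs) (there y∈xs) y≢x = there (∈-─ x∈xs y∈xs y≢x)

sum-mono-⊆ : ∀ {xs} L → Unique L → All (_∈ xs) L → sum L ≤ sum xs
sum-mono-⊆ [] _ _ = z≤n
sum-mono-⊆ {xs} (y ∷ L) (y∉L ∷ uniqueL) (y∈xs ∷ L⊆xs) = begin
  y + sum L             ≤⟨ +-monoʳ-≤ y (sum-mono-⊆ L uniqueL L⊆xs─y) ⟩
  y + sum (xs ─ y∈xs)   ≡⟨ sum-─ y∈xs ⟨
  sum xs                ∎
  where
  open ≤-Reasoning
  L⊆xs─y : All (_∈ xs ─ y∈xs) L
  L⊆xs─y = All.zipWith (λ (y≢z , z∈xs) → ∈-─ y∈xs z∈xs (y≢z ∘ sym)) (y∉L , L⊆xs)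

subsetSum≤sum : ∀ {xs k} → IsSubsetSum (_∈ xs) k → k ≤ sum xs
subsetSum≤sum (L , uniqueL , L⊆xs , refl) = sum-mono-⊆ L uniqueL L⊆xs

subsetSum-∷⁻ : ∀ {x xs k} → IsSubsetSum (_∈ x ∷ xs) k → x ≤ k ⊎ IsSubsetSum (_∈ xs) k
subsetSum-∷⁻ {x} {xs} (L , uniqueL , L⊆ , refl) with x ∈? L
... | yes x∈L = inj₁ (∈⇒≤sum x∈L)
... | no  x∉L = inj₂ (L , uniqueL , All.tabulate L⊆xs , refl)
  where
  L⊆xs : ∀ {z} → z ∈ L → z ∈ xs
  L⊆xs z∈L = ∈-─ (here refl) (All.lookup L⊆ z∈L) (λ { refl → x∉L z∈L })

filter-cong-All : ∀ {P Q : Pred ℕ 0ℓ} (P? : Decidable P) (Q? : Decidable Q) {xs} →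
                  All (λ x → P x ⇔ Q x) xs → filter P? xs ≡ filter Q? xs
filter-cong-All P? Q? [] = refl
filter-cong-All P? Q? {x ∷ xs} (Px⇔Qx ∷ P⇔Q) with P? x
... | yes Px = trans (cong (x ∷_) (filter-cong-All P? Q? P⇔Q)) (sym (filter-accept Q? (to Px⇔Qx Px)))
... | no ¬Px = trans (filter-cong-All P? Q? P⇔Q) (sym (filter-reject Q? (¬Px ∘ from Px⇔Qx)))

complete : List ℕ → Bool
complete []       = true
complete (x ∷ xs) = (x ≤ᵇ suc (sum xs)) ∧ complete xs

complete-∷ : ∀ x xs → T (complete (x ∷ xs)) ⇔ (x ≤ suc (sum xs) × T (complete xs))
complete-∷ x xs = mk⇔
  (λ c → let (x≤ , cxs) = to T-∧ c in ≤ᵇ⇒≤ x _ x≤ , cxs)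
  (λ (x≤ , cxs) → from T-∧ (≤⇒≤ᵇ x≤ , cxs))

complete⇒subsetSum : ∀ {xs} → Unique xs → T (complete xs) →
                     ∀ {k} → k ≤ sum xs → IsSubsetSum (_∈ xs) k
complete⇒subsetSum {[]} _ _ {zero} _ = [] , [] , [] , refl
complete⇒subsetSum {x ∷ xs} (x∉xs ∷ uniqueXs) c {k} k≤ with to (complete-∷ x xs) c | k ≤? sum xs
... | _ , cxs | yes k≤sum with complete⇒subsetSum uniqueXs cxs k≤sum
...   | L , uniqueL , L⊆ , refl = L , uniqueL , All.map there L⊆ , refl
complete⇒subsetSum {x ∷ xs} (x∉xs ∷ uniqueXs) c {k} k≤ | x≤ , cxs | no k≰sum
  with complete⇒subsetSum uniqueXs cxs (m≤n+o⇒m∸n≤o k x k≤)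
...   | L , uniqueL , L⊆ , s =
  x ∷ L , All.map (All.lookup x∉xs) L⊆ ∷ uniqueL , here refl ∷ All.map there L⊆ ,
  trans (cong (x +_) s) (m+[n∸m]≡n (≤-trans x≤ (≰⇒> k≰sum)))

complete⇒practical : ∀ {xs} → Unique xs → T (complete xs) → Practical (_∈ xs)
complete⇒practical uniqueXs c k (L , uniqueL , L⊆xs , k≤) =
  complete⇒subsetSum uniqueXs c (≤-trans k≤ (sum-mono-⊆ L uniqueL L⊆xs))

gap-∷ : ∀ {x xs k} → k < x → ¬ IsSubsetSum (_∈ xs) k → ¬ IsSubsetSum (_∈ x ∷ xs) k
gap-∷ k<x gap = [ <⇒≱ k<x , gap ] ∘ subsetSum-∷⁻

-- The gap is found at the first element x exceeding 1 + (sum of the later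
-- ones); the bound k < x lets it survive prepending the larger elements.
incomplete⇒gap : ∀ {x xs} → Descending (x ∷ xs) → ¬ T (complete (x ∷ xs)) →
                 Σ ℕ λ k → k < x × k ≤ sum (x ∷ xs) × ¬ IsSubsetSum (_∈ x ∷ xs) k
incomplete⇒gap {x} {xs} _ ¬c with x ≤? suc (sum xs)
... | no x≰ = suc (sum xs) , ≰⇒> x≰ , ≤-trans (<⇒≤ (≰⇒> x≰)) (m≤m+n x (sum xs)) ,
              gap-∷ (≰⇒> x≰) (1+n≰n ∘ subsetSum≤sum)
incomplete⇒gap {x} {[]} _ ¬c | yes x≤ = ⊥-elim (¬c (from (complete-∷ x []) (x≤ , _)))
incomplete⇒gap {x} {y ∷ ys} (x>xs ∷ desc) ¬c | yes x≤
  with incomplete⇒gap desc (¬c ∘ from (complete-∷ x (y ∷ ys)) ∘ (x≤ ,_))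
... | k , k<y , k≤ , gap = k , k<x , ≤-trans k≤ (m≤n+m _ x) , gap-∷ k<x gap
  where
  k<x : k < x
  k<x = <-trans k<y (All.head x>xs)

practical⇒complete : ∀ {xs} → Descending xs → Practical (_∈ xs) → T (complete xs)
practical⇒complete {[]} _ _ = _
practical⇒complete {x ∷ xs} desc practical with T? (complete (x ∷ xs))
... | yes c = c
... | no ¬c with incomplete⇒gap desc ¬c
...   | k , _ , k≤ , gap =
  ⊥-elim (gap (practical k (x ∷ xs , descending⇒unique desc , All.tabulate id , k≤)))

Practical-resp-≐ : ∀ {X Y : Pred ℕ 0ℓ} → X ≐ Y → Practical X → Practical Y
Practical-resp-≐ (X⊆Y , Y⊆X) practical k (L , uniqueL , L⊆Y , k≤)
  with practical k (L , uniqueL , All.map Y⊆X L⊆Y , k≤)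
... | L′ , uniqueL′ , L′⊆X , s = L′ , uniqueL′ , All.map X⊆Y L′⊆X , s

practical⇔complete : ∀ {X xs} → Descending xs → X ≐ (_∈ xs) → Practical X ⇔ T (complete xs)
practical⇔complete desc X≐xs = mk⇔
  (practical⇒complete desc ∘ Practical-resp-≐ X≐xs)
  (Practical-resp-≐ (≐-sym X≐xs) ∘ complete⇒practical (descending⇒unique desc))

DivIn-resp-≐ : ∀ m {X Y : Pred ℕ 0ℓ} → X ≐ Y → DivIn m X ≐ DivIn m Y
DivIn-resp-≐ m (X⊆Y , Y⊆X) =
  (λ (1≤d , d∣m , Xd) → 1≤d , d∣m , X⊆Y Xd) , (λ (1≤d , d∣m , Yd) → 1≤d , d∣m , Y⊆X Yd)

Pr-resp-≐ : ∀ {X Y : Pred ℕ 0ℓ} → X ≐ Y → Pr X ≐ Pr Y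
Pr-resp-≐ X≐Y =
  (λ {m} (1≤m , practical) → 1≤m , Practical-resp-≐ (DivIn-resp-≐ m X≐Y) practical) ,
  (λ {m} (1≤m , practical) → 1≤m , Practical-resp-≐ (DivIn-resp-≐ m (≐-sym X≐Y)) practical)

Members : (ℕ → Bool) → Pred ℕ 0ℓ
Members f n = 1 ≤ n × T (f n)

divIn? : ∀ m f → Decidable (DivIn m (Members f))
divIn? m f d = 1 ≤? d ×-dec d ∣? m ×-dec 1 ≤? d ×-dec T? (f d)

divisorsIn : (ℕ → Bool) → ℕ → List ℕ
divisorsIn f m = filter (divIn? m f) (downFrom (suc m))

properDivisorsIn : (ℕ → Bool) → ℕ → List ℕ
properDivisorsIn f m = filter (divIn? m f) (downFrom m)

divisorsIn-descending : ∀ f m → Descending (divisorsIn f m)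
divisorsIn-descending f m = filter⁺ (divIn? m f) (applyDownFrom⁺₁ id (suc m) λ j<i _ → j<i)

divisorsIn-≐ : ∀ f n → DivIn (suc n) (Members f) ≐ (_∈ divisorsIn f (suc n))
divisorsIn-≐ f n =
  (λ d∈D@(_ , d∣m , _) → ∈-filter⁺ (divIn? (suc n) f) (∈-downFrom⁺ (s≤s (∣⇒≤ d∣m))) d∈D) ,
  proj₂ ∘ ∈-filter⁻ (divIn? (suc n) f) {xs = downFrom (suc (suc n))}

divisorsIn-suc : ∀ f n → divisorsIn f (suc n) ≡
                 (if f (suc n) then suc n ∷ properDivisorsIn f (suc n) else properDivisorsIn f (suc n))
divisorsIn-suc f n = by-cases (f (suc n)) refl
  where
  by-cases : ∀ b → f (suc n) ≡ b → divisorsIn f (suc n) ≡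
             (if b then suc n ∷ properDivisorsIn f (suc n) else properDivisorsIn f (suc n))
  by-cases true  fm = filter-accept (divIn? (suc n) f) {xs = downFrom (suc n)}
                         (s≤s z≤n , ∣-refl , s≤s z≤n , subst T (sym fm) _)
  by-cases false fm = filter-reject (divIn? (suc n) f) {xs = downFrom (suc n)}
                         (λ (_ , _ , _ , t) → subst T fm t)

properDivisorsIn-cong : ∀ {f g} m → (∀ {d} → d < m → f d ≡ g d) →
                        properDivisorsIn f m ≡ properDivisorsIn g m
properDivisorsIn-cong {f} {g} m f≗g = filter-cong-All (divIn? m f) (divIn? m g) (All.tabulate agree)
  where
  agree : ∀ {d} → d ∈ downFrom m → DivIn m (Members f) d ⇔ DivIn m (Members g) d
  agree d∈ = mk⇔ (λ (p , q , r , t) → p , q , r , subst T fd≡gd t)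
                 (λ (p , q , r , t) → p , q , r , subst T (sym fd≡gd) t)
    where fd≡gd = f≗g (∈-downFrom⁻ d∈)

Pr-Members : ∀ f g → (∀ n → g (suc n) ≡ complete (divisorsIn f (suc n))) → Members g ≐ Pr (Members f)
Pr-Members f g g≡complete = (λ {m} → Members⊆Pr m) , (λ {m} → Pr⊆Members m)
  where
  criterion : ∀ n → Practical (DivIn (suc n) (Members f)) ⇔ T (complete (divisorsIn f (suc n)))
  criterion n = practical⇔complete (divisorsIn-descending f (suc n)) (divisorsIn-≐ f n)
  Members⊆Pr : ∀ m → Members g m → Pr (Members f) m
  Members⊆Pr (suc n) (1≤m , gm) = 1≤m , from (criterion n) (subst T (g≡complete n) gm)
  Pr⊆Members : ∀ m → Pr (Members f) m → Members g m
  Pr⊆Members (suc n) (1≤m , practical) = 1≤m , subst T (sym (g≡complete n)) (to (criterion n) practical)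

module CourseOfValues {B : Set} (b₀ : B) (step : ℕ → (ℕ → B) → B)
  (step-cong : ∀ m {f g} → (∀ {i} → i < m → f i ≡ g i) → step m f ≡ step m g) where

  -- b₀ only fills table 0, which step 0 never inspects.
  private
    table : ℕ → ℕ → B
    table zero    _ = b₀
    table (suc n) i = if i <ᵇ n then table n i else step n (table n)

  opaque
    fix : ℕ → B
    fix m = step m (table m)

    fix-unfold : ∀ m → fix m ≡ step m fix
    fix-unfold m = step-cong m table-fix
      where
      table-fix : ∀ {n i} → i < n → table n i ≡ fix i
      table-fix {suc n} {i} i<1+n with i <ᵇ n in i<ᵇn
      ... | true  = table-fix (<ᵇ⇒< i n (subst T (sym i<ᵇn) _))
      ... | false with ≤-antisym (≤-pred i<1+n) (≮⇒≥ (subst T i<ᵇn ∘ <⇒<ᵇ))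
      ...   | refl = refl

completeIf : Bool → Bool → Bool → Bool
completeIf c o p = if c then o ∧ p else p

complete-if : ∀ c x L → complete (if c then x ∷ L else L) ≡ completeIf c (x ≤ᵇ suc (sum L)) (complete L)
complete-if true  _ _ = refl
complete-if false _ _ = refl

-- completeIf is antitone in its first argument, so a ↦ completeIf (completeIf a o p) o′ p′
-- is monotone on Bool, and its value completeIf p o′ p′ at false is a fixed point.
completeIf-fixed : ∀ o p o′ p′ → let a = completeIf p o′ p′ in completeIf (completeIf a o p) o′ p′ ≡ a
completeIf-fixed true  false _     true  = refl
completeIf-fixed false false _     true  = refl
completeIf-fixed _     false _     false = refl
completeIf-fixed true  true  true  true  = refl
completeIf-fixed false true  true  true  = refl
completeIf-fixed _     true  false _     = refl
completeIf-fixed _     true  true  false = refl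

Consistent : ℕ → List ℕ → List ℕ → Bool × Bool → Set
Consistent m LA LB (x , y) = y ≡ complete (if x then m ∷ LA else LA) ×
                             x ≡ complete (if y then m ∷ LB else LB)

choose : ℕ → List ℕ → List ℕ → Bool × Bool
choose m LA LB = x , completeIf x (m ≤ᵇ suc (sum LA)) (complete LA)
  where
  x : Bool
  x = completeIf (complete LA) (m ≤ᵇ suc (sum LB)) (complete LB)

choose-consistent : ∀ m LA LB → Consistent m LA LB (choose m LA LB)
choose-consistent m LA LB =
  sym (complete-if x m LA) ,
  trans (sym (completeIf-fixed (m ≤ᵇ suc (sum LA)) (complete LA) (m ≤ᵇ suc (sum LB)) (complete LB)))
        (sym (complete-if y m LB))
  where
  x y : Bool
  x = proj₁ (choose m LA LB)
  y = proj₂ (choose m LA LB)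

step : ℕ → (ℕ → Bool × Bool) → Bool × Bool
step m ab = choose m (properDivisorsIn (proj₁ ∘ ab) m) (properDivisorsIn (proj₂ ∘ ab) m)

step-cong : ∀ m {f g : ℕ → Bool × Bool} → (∀ {i} → i < m → f i ≡ g i) → step m f ≡ step m g
step-cong m f≗g = cong₂ (choose m) (properDivisorsIn-cong m (cong proj₁ ∘ f≗g))
                                   (properDivisorsIn-cong m (cong proj₂ ∘ f≗g))

open CourseOfValues (false , false) step step-cong

inA inB : ℕ → Bool
inA = proj₁ ∘ fix
inB = proj₂ ∘ fix

inA-inB-consistent : ∀ n → inB (suc n) ≡ complete (divisorsIn inA (suc n)) ×
                           inA (suc n) ≡ complete (divisorsIn inB (suc n))
inA-inB-consistent n
  with subst (Consistent (suc n) LA LB) (sym (fix-unfold (suc n))) (choose-consistent (suc n) LA LB)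
  where
  LA LB : List ℕ
  LA = properDivisorsIn inA (suc n)
  LB = properDivisorsIn inB (suc n)
... | inB≡ , inA≡ = trans inB≡ (cong complete (sym (divisorsIn-suc inA n))) ,
                    trans inA≡ (cong complete (sym (divisorsIn-suc inB n)))

theorem4p15 : Σ (Pred ℕ 0ℓ) λ A → (∀ n → A n → 1 ≤ n) × (A ≐ Pr (Pr A))
theorem4p15 = Members inA , (λ _ → proj₁) ,
  ≐-trans (Pr-Members inB inA (proj₂ ∘ inA-inB-consistent))
          (Pr-resp-≐ (Pr-Members inA inB (proj₁ ∘ inA-inB-consistent)))
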